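{- Let $b,\ell\ge 0$ be integers with $\ell\ge 4b+5$. If $x,y,z\in\mathbb{R}$ satisfy $x\preceq_b^\ell y$, $y\preceq_b^\ell z$ and $x\sim_b^\ell z$, then $x\preceq_b^\ell z$.
   Context: For a positive integer $W$, $\mathbb{Q}[W]$ is the set of rationals $p/q$ with integers $|p|<W$, $0<q<W$. For integers $b,\ell\ge 0$, reals $x,y$ are $(b,\ell)$-similar, written $x\sim_b^\ell y$, if there exists $\frac{p}{q}\in\mathbb{Q}[2^b]$ with $\left|x-y-\frac{p}{q}\right|\le 2^{ -\ell}$. When $\ell\ge 2b+2$ such a $\frac{p}{q}$ is unique, and $x$ is $(b,\ell)$-smaller than $y$, written $x\preceq_b^\ell y$, if $x\sim_b^\ell y$ and for the unique $\frac{p}{q}\in\mathbb{Q}[2^b]$ with $\left|x-y-\frac{p}{q}\right|\le 2^{ -\ell}$ we have $x-y\le\frac{p}{q}$. -}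

module Defs where

open import Level using (0ℓ)
open import Data.Nat using (ℕ; zero; suc; _^_) renaming (_<_ to _<ℕ_)
open import Data.Integer using (ℤ; +_; -[1+_]) renaming (_<_ to _<ℤ_; -_ to ℤ-)
open import Data.Product using (Σ; _×_; ∃)
open import Relation.Nullary using (¬_)
open import Relation.Binary.Structures using (IsTotalOrder)
open import Algebra.Structures using (IsCommutativeRing)

-- The real numbers, axiomatised as a complete ordered field.
-- (agda-stdlib has no real numbers; any model of these axioms is
-- isomorphic to ℝ, so quantifying over all models is faithful.)
record RealField : Set₁ where
  infixl 6 _+_ _-_
  infixl 7 _*_
  infix 4 _≈_ _≤_
  field
    Carrier : Set
    _≈_     : Carrier → Carrier → Set
    _+_ _*_ : Carrier → Carrier → Carrier
    -_      : Carrier → Carrier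
    0# 1#   : Carrier
    _⁻¹     : Carrier → Carrier
    _≤_     : Carrier → Carrier → Set
    isCommutativeRing : IsCommutativeRing _≈_ _+_ _*_ -_ 0# 1#
    0≉1       : ¬ (0# ≈ 1#)
    ⁻¹-inverse : ∀ x → ¬ (x ≈ 0#) → x * (x ⁻¹) ≈ 1#
    isTotalOrder : IsTotalOrder _≈_ _≤_
    +-mono-≤  : ∀ x y z → x ≤ y → x + z ≤ y + z
    *-nonneg  : ∀ x y → 0# ≤ x → 0# ≤ y → 0# ≤ x * y
    sup : (S : Carrier → Set) → (∃ λ x → S x) →
          (∃ λ u → ∀ x → S x → x ≤ u) →
          ∃ λ s → ((∀ x → S x → x ≤ s) ×
                   (∀ u → (∀ x → S x → x ≤ u) → s ≤ u))

  _-_ : Carrier → Carrier → Carrier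
  x - y = x + (- y)

  _/_ : Carrier → Carrier → Carrier
  x / y = x * (y ⁻¹)

  fromℕ : ℕ → Carrier
  fromℕ zero    = 0#
  fromℕ (suc n) = 1# + fromℕ n

  fromℤ : ℤ → Carrier
  fromℤ (+ n)     = fromℕ n
  fromℤ -[1+ n ]  = - (1# + fromℕ n)

  ∣_∣≤_ : Carrier → Carrier → Set
  ∣ a ∣≤ e = (- e ≤ a) × (a ≤ e)

  2^-_ : ℕ → Carrier
  2^- ℓ = 1# / fromℕ (2 ^ ℓ)

  InQ : ℕ → ℤ → ℕ → Set
  InQ W p q = (ℤ- (+ W) <ℤ p) × (p <ℤ + W) × (0 <ℕ q) × (q <ℕ W)

  _over_ : ℤ → ℕ → Carrier
  p over q = fromℤ p / fromℕ q

  Similar : ℕ → ℕ → Carrier → Carrier → Set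
  Similar b ℓ x y = Σ ℤ λ p → Σ ℕ λ q →
    InQ (2 ^ b) p q × ∣ (x - y) - (p over q) ∣≤ (2^- ℓ)

  -- x ⪯_b^ℓ y  (meaningful when ℓ ≥ 2b+2, where the p/q is unique):
  -- x ~ y and for the (unique) p/q witnessing similarity, x - y ≤ p/q.
  Smaller : ℕ → ℕ → Carrier → Carrier → Set
  Smaller b ℓ x y = Similar b ℓ x y ×
    (∀ (p : ℤ) (q : ℕ) → InQ (2 ^ b) p q →
       ∣ (x - y) - (p over q) ∣≤ (2^- ℓ) → x - y ≤ p over q)

{-# OPTIONS --safe #-}
-- Let sᵢ = pᵢ/qᵢ witness x ∼ y, y ∼ z and x ∼ z.  From x ⪯ y and y ⪯ z,
-- x - z ≤ s₁ + s₂, so it suffices that t = s₁ + s₂ - s₃ ≤ 0.  The three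
-- 2^-ℓ-closeness bounds give t ≤ 3·2^-ℓ, so the integer q₁q₂q₃·t is at most
-- 3·q₁q₂q₃·2^-ℓ < 2^(3b+2)·2^-ℓ ≤ 1, hence at most 0.  This needs only
-- ℓ ≥ 3b + 2, and it works for every witness s₃.
module Submission where

open import Defs
open import Level using (0ℓ)
import Data.Nat as ℕ
import Data.Nat.Properties as ℕ
open import Data.Nat using (ℕ; zero; suc)
import Data.Integer as ℤ
import Data.Integer.Properties as ℤ
open import Data.Integer using (ℤ; +_; -[1+_])
open import Data.Sign as Sign using (Sign)
open import Data.Product using (Σ; _,_)
open import Data.Sum using (inj₁; inj₂)
import Data.Maybe as Maybe
open import Relation.Nullary.Decidable using (decToMaybe)
open import Function using (_∘_)
open import Relation.Nullary using (¬_; contradiction)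
open import Relation.Binary.Bundles using (Poset)
open import Relation.Binary.Structures using (IsTotalOrder)
open import Relation.Binary.PropositionalEquality as ≡ using (_≡_)
open import Algebra.Bundles using (CommutativeRing)
open import Algebra.Solver.Ring.AlmostCommutativeRing using (fromCommutativeRing; _-Raw-AlmostCommutative⟶_)

module _ where
  open import Data.Nat using (_<_; _*_; _+_; _^_)
  open import Data.Nat.Properties
  open import Data.Nat.Tactic.RingSolver using (solve-∀)

  triple-product-bound : ∀ b {q₁ q₂ q₃} → q₁ < 2 ^ b → q₂ < 2 ^ b → q₃ < 2 ^ b →
                         q₁ * q₂ * q₃ * 3 < 2 ^ (3 * b + 2)
  triple-product-bound b {q₁} {q₂} {q₃} q₁< q₂< q₃< = begin-strict
    q₁ * q₂ * q₃ * 3     <⟨ *-monoˡ-< 3 (*-mono-< (*-mono-< q₁< q₂<) q₃<) ⟩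
    B * B * B * 3        ≤⟨ *-monoʳ-≤ (B * B * B) (n≤1+n 3) ⟩
    B * B * B * 4        ≡⟨ cube-times-four B ⟩
    B ^ 3 * 4            ≡⟨ ≡.cong (_* 4) (^-*-assoc 2 b 3) ⟩
    2 ^ (b * 3) * 4      ≡⟨ ^-distribˡ-+-* 2 (b * 3) 2 ⟨
    2 ^ (b * 3 + 2)      ≡⟨ ≡.cong (λ e → 2 ^ (e + 2)) (*-comm b 3) ⟩
    2 ^ (3 * b + 2)      ∎
    where
    open ≤-Reasoning
    B : ℕ
    B = 2 ^ b
    -- the right-hand side is n ^ 3 * 4 unfolded: the solver does not treat _^_
    cube-times-four : ∀ n → n * n * n * 4 ≡ n * (n * (n * 1)) * 4
    cube-times-four = solve-∀

module RealFieldProperties (R : RealField) where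
  open RealField R

  commutativeRing : CommutativeRing 0ℓ 0ℓ
  commutativeRing = record { isCommutativeRing = isCommutativeRing }

  open CommutativeRing commutativeRing
    using (refl; sym; trans; reflexive; +-cong; *-cong; -‿cong; +-comm; +-assoc;
           +-identityˡ; +-identityʳ; -‿inverseʳ; *-identityˡ; *-identityʳ; zeroˡ; zeroʳ; distribʳ; ring)
  open import Algebra.Properties.Ring ring
    using (-0#≈0#; -1*x≈-x; -‿involutive; -‿+-comm; -‿distribˡ-*; -‿distribʳ-*)
  open IsTotalOrder isTotalOrder
    using (total; antisym; isPartialOrder) renaming (reflexive to ≈⇒≤; refl to ≤-refl; trans to ≤-trans)

  poset : Poset 0ℓ 0ℓ 0ℓ
  poset = record { isPartialOrder = isPartialOrder }

  open import Relation.Binary.Reasoning.PartialOrder poset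

  fromℕ-+ : ∀ m n → fromℕ (m ℕ.+ n) ≈ fromℕ m + fromℕ n
  fromℕ-+ zero    n = sym (+-identityˡ (fromℕ n))
  fromℕ-+ (suc m) n = trans (+-cong refl (fromℕ-+ m n)) (sym (+-assoc 1# (fromℕ m) (fromℕ n)))

  fromℕ-* : ∀ m n → fromℕ (m ℕ.* n) ≈ fromℕ m * fromℕ n
  fromℕ-* zero    n = sym (zeroˡ (fromℕ n))
  fromℕ-* (suc m) n = begin-equality
    fromℕ (n ℕ.+ m ℕ.* n)            ≈⟨ fromℕ-+ n (m ℕ.* n) ⟩
    fromℕ n + fromℕ (m ℕ.* n)        ≈⟨ +-cong (sym (*-identityˡ (fromℕ n))) (fromℕ-* m n) ⟩
    1# * fromℕ n + fromℕ m * fromℕ n ≈⟨ distribʳ (fromℕ n) 1# (fromℕ m) ⟨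
    fromℕ (suc m) * fromℕ n          ∎

  [c+a]-[c+b]≈a-b : ∀ c a b → (c + a) - (c + b) ≈ a - b
  [c+a]-[c+b]≈a-b c a b = begin-equality
    (c + a) - (c + b)      ≈⟨ +-cong (+-comm a c) (-‿+-comm c b) ⟨
    (a + c) + (- c - b)    ≈⟨ +-assoc a c (- c - b) ⟩
    a + (c + (- c - b))    ≈⟨ +-cong refl (+-assoc c (- c) (- b)) ⟨
    a + ((c - c) - b)      ≈⟨ +-cong refl (+-cong (-‿inverseʳ c) refl) ⟩
    a + (0# - b)           ≈⟨ +-cong refl (+-identityˡ (- b)) ⟩
    a - b                  ∎

  fromℤ-⊖ : ∀ m n → fromℤ (m ℤ.⊖ n) ≈ fromℕ m - fromℕ n
  fromℤ-⊖ m       zero    = sym (trans (+-cong refl -0#≈0#) (+-identityʳ (fromℕ m)))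
  fromℤ-⊖ zero    (suc n) = sym (+-identityˡ _)
  fromℤ-⊖ (suc m) (suc n) = begin-equality
    fromℤ (suc m ℤ.⊖ suc n)          ≡⟨ ≡.cong fromℤ (ℤ.[1+m]⊖[1+n]≡m⊖n m n) ⟩
    fromℤ (m ℤ.⊖ n)                  ≈⟨ fromℤ-⊖ m n ⟩
    fromℕ m - fromℕ n                ≈⟨ [c+a]-[c+b]≈a-b 1# (fromℕ m) (fromℕ n) ⟨
    fromℕ (suc m) - fromℕ (suc n)    ∎

  fromℤ-+ : ∀ i j → fromℤ (i ℤ.+ j) ≈ fromℤ i + fromℤ j
  fromℤ-+ (+ m)    (+ n)    = fromℕ-+ m n
  fromℤ-+ (+ m)    -[1+ n ] = fromℤ-⊖ m (suc n)
  fromℤ-+ -[1+ m ] (+ n)    = trans (fromℤ-⊖ n (suc m)) (+-comm (fromℕ n) _)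
  fromℤ-+ -[1+ m ] -[1+ n ] = begin-equality
    - fromℕ (suc (suc (m ℕ.+ n)))             ≡⟨ ≡.cong (λ k → - fromℕ (suc k)) (ℕ.+-suc m n) ⟨
    - fromℕ (suc m ℕ.+ suc n)                 ≈⟨ -‿cong (fromℕ-+ (suc m) (suc n)) ⟩
    - (fromℕ (suc m) + fromℕ (suc n))         ≈⟨ -‿+-comm (fromℕ (suc m)) (fromℕ (suc n)) ⟨
    - fromℕ (suc m) - fromℕ (suc n)           ∎

  fromℤ-neg : ∀ i → fromℤ (ℤ.- i) ≈ - fromℤ i
  fromℤ-neg (+ zero)  = sym -0#≈0#
  fromℤ-neg (+ suc n) = refl
  fromℤ-neg -[1+ n ]  = sym (-‿involutive _)

  signed : Sign → Carrier → Carrier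
  signed Sign.+ a = a
  signed Sign.- a = - a

  fromℤ-◃ : ∀ s n → fromℤ (s ℤ.◃ n) ≈ signed s (fromℕ n)
  fromℤ-◃ Sign.+ zero    = refl
  fromℤ-◃ Sign.- zero    = sym -0#≈0#
  fromℤ-◃ Sign.+ (suc n) = refl
  fromℤ-◃ Sign.- (suc n) = refl

  fromℤ-signAbs : ∀ i → fromℤ i ≈ signed (ℤ.sign i) (fromℕ ℤ.∣ i ∣)
  fromℤ-signAbs (+ n)    = refl
  fromℤ-signAbs -[1+ n ] = refl

  signed-* : ∀ s t a b → signed (s Sign.* t) (a * b) ≈ signed s a * signed t b
  signed-* Sign.+ Sign.+ a b = refl
  signed-* Sign.+ Sign.- a b = -‿distribʳ-* a b
  signed-* Sign.- Sign.+ a b = -‿distribˡ-* a b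
  signed-* Sign.- Sign.- a b = begin-equality
    a * b          ≈⟨ -‿involutive (a * b) ⟨
    - (- (a * b))  ≈⟨ -‿cong (-‿distribˡ-* a b) ⟩
    - (- a * b)    ≈⟨ -‿distribʳ-* (- a) b ⟩
    - a * - b      ∎

  signed-cong : ∀ s {a b} → a ≈ b → signed s a ≈ signed s b
  signed-cong Sign.+ a≈b = a≈b
  signed-cong Sign.- a≈b = -‿cong a≈b

  fromℤ-* : ∀ i j → fromℤ (i ℤ.* j) ≈ fromℤ i * fromℤ j
  fromℤ-* i j = begin-equality
    fromℤ (s Sign.* t ℤ.◃ ∣i∣ ℕ.* ∣j∣)          ≈⟨ fromℤ-◃ (s Sign.* t) (∣i∣ ℕ.* ∣j∣) ⟩
    signed (s Sign.* t) (fromℕ (∣i∣ ℕ.* ∣j∣))   ≈⟨ signed-cong (s Sign.* t) (fromℕ-* ∣i∣ ∣j∣) ⟩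
    signed (s Sign.* t) (fromℕ ∣i∣ * fromℕ ∣j∣) ≈⟨ signed-* s t (fromℕ ∣i∣) (fromℕ ∣j∣) ⟩
    signed s (fromℕ ∣i∣) * signed t (fromℕ ∣j∣) ≈⟨ *-cong (fromℤ-signAbs i) (fromℤ-signAbs j) ⟨
    fromℤ i * fromℤ j                           ∎
    where
    s t : Sign
    s = ℤ.sign i
    t = ℤ.sign j
    ∣i∣ ∣j∣ : ℕ
    ∣i∣ = ℤ.∣ i ∣
    ∣j∣ = ℤ.∣ j ∣

  fromℤ-morphism : ℤ.+-*-rawRing -Raw-AlmostCommutative⟶ fromCommutativeRing commutativeRing
  fromℤ-morphism = record
    { ⟦_⟧ = fromℤ ; +-homo = fromℤ-+ ; *-homo = fromℤ-* ; -‿homo = fromℤ-neg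
    ; 0-homo = refl ; 1-homo = +-identityʳ 1# }

  open import Algebra.Solver.Ring ℤ.+-*-rawRing (fromCommutativeRing commutativeRing) fromℤ-morphism
    (λ i j → Maybe.map (reflexive ∘ ≡.cong fromℤ) (decToMaybe (i ℤ.≟ j)))
    using (solve; _:=_; _:+_; _:*_; :-_; _:-_; con)

  +-monoʳ-≤ : ∀ c {a b} → a ≤ b → c + a ≤ c + b
  +-monoʳ-≤ c {a} {b} a≤b = begin
    c + a  ≈⟨ +-comm c a ⟩
    a + c  ≤⟨ +-mono-≤ a b c a≤b ⟩
    b + c  ≈⟨ +-comm b c ⟩
    c + b  ∎

  +-mono₂-≤ : ∀ {a b c d} → a ≤ b → c ≤ d → a + c ≤ b + d
  +-mono₂-≤ {a} {b} {c} a≤b c≤d = ≤-trans (+-mono-≤ a b c a≤b) (+-monoʳ-≤ b c≤d)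

  +-cancelˡ-≤ : ∀ c {a b} → c + a ≤ c + b → a ≤ b
  +-cancelˡ-≤ c {a} {b} c+a≤c+b = begin
    a                ≈⟨ solve 2 (λ c a → a := (:- c) :+ (c :+ a)) refl c a ⟩
    - c + (c + a)    ≤⟨ +-monoʳ-≤ (- c) c+a≤c+b ⟩
    - c + (c + b)    ≈⟨ solve 2 (λ c b → (:- c) :+ (c :+ b) := b) refl c b ⟩
    b                ∎

  neg-antimono-≤ : ∀ {a b} → a ≤ b → - b ≤ - a
  neg-antimono-≤ {a} {b} a≤b = begin
    - b            ≈⟨ solve 2 (λ a b → :- b := a :+ ((:- a) :- b)) refl a b ⟩
    a + (- a - b)  ≤⟨ +-mono-≤ a b _ a≤b ⟩
    b + (- a - b)  ≈⟨ solve 2 (λ a b → b :+ ((:- a) :- b) := :- a) refl a b ⟩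
    - a            ∎

  x-y≤0⇒x≤y : ∀ {x y} → x - y ≤ 0# → x ≤ y
  x-y≤0⇒x≤y {x} {y} x-y≤0 = begin
    x            ≈⟨ solve 2 (λ x y → x := (x :- y) :+ y) refl x y ⟩
    (x - y) + y  ≤⟨ +-mono-≤ _ _ y x-y≤0 ⟩
    0# + y       ≈⟨ +-identityˡ y ⟩
    y            ∎

  *-monoˡ-≤-nonNeg : ∀ {k a b} → 0# ≤ k → a ≤ b → k * a ≤ k * b
  *-monoˡ-≤-nonNeg {k} {a} {b} 0≤k a≤b = begin
    k * a                ≈⟨ +-identityˡ (k * a) ⟨
    0# + k * a           ≤⟨ +-mono-≤ _ _ (k * a) (*-nonneg k (b - a) 0≤k 0≤b-a) ⟩
    k * (b - a) + k * a  ≈⟨ solve 3 (λ k a b → k :* (b :- a) :+ k :* a := k :* b) refl k a b ⟩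
    k * b                ∎
    where
    0≤b-a : 0# ≤ b - a
    0≤b-a = begin
      0#     ≈⟨ solve 1 (λ a → con (+ 0) := a :- a) refl a ⟩
      a - a  ≤⟨ +-mono-≤ a b (- a) a≤b ⟩
      b - a  ∎

  0≤1 : 0# ≤ 1#
  0≤1 with total 0# 1#
  ... | inj₁ 0≤1′ = 0≤1′
  ... | inj₂ 1≤0 = begin
    0#           ≤⟨ *-nonneg (- 1#) (- 1#) 0≤-1 0≤-1 ⟩
    - 1# * - 1#  ≈⟨ trans (-1*x≈-x (- 1#)) (-‿involutive 1#) ⟩
    1#           ∎
    where
    0≤-1 : 0# ≤ - 1#
    0≤-1 = ≤-trans (≈⇒≤ (sym -0#≈0#)) (neg-antimono-≤ 1≤0)

  1≰0 : ¬ (1# ≤ 0#)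
  1≰0 1≤0 = 0≉1 (antisym 0≤1 1≤0)

  k*t≤0⇒t≤0 : ∀ {k t} → 0# ≤ k → ¬ (k ≈ 0#) → k * t ≤ 0# → t ≤ 0#
  k*t≤0⇒t≤0 {k} {t} 0≤k k≉0 kt≤0 with total t 0#
  ... | inj₁ t≤0 = t≤0
  ... | inj₂ 0≤t = ≈⇒≤ (begin-equality
    t                 ≈⟨ *-identityˡ t ⟨
    1# * t            ≈⟨ *-cong (⁻¹-inverse k k≉0) refl ⟨
    (k * k ⁻¹) * t    ≈⟨ solve 3 (λ k k⁻¹ t → (k :* k⁻¹) :* t := k⁻¹ :* (k :* t)) refl k (k ⁻¹) t ⟩
    k ⁻¹ * (k * t)    ≈⟨ *-cong refl (antisym kt≤0 (*-nonneg k t 0≤k 0≤t)) ⟩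
    k ⁻¹ * 0#         ≈⟨ zeroʳ (k ⁻¹) ⟩
    0#                ∎)

  0≤fromℕ : ∀ n → 0# ≤ fromℕ n
  0≤fromℕ zero    = ≤-refl
  0≤fromℕ (suc n) = ≤-trans (≈⇒≤ (sym (+-identityˡ 0#))) (+-mono₂-≤ 0≤1 (0≤fromℕ n))

  1≤fromℕ-suc : ∀ n → 1# ≤ fromℕ (suc n)
  1≤fromℕ-suc n = ≤-trans (≈⇒≤ (sym (+-identityʳ 1#))) (+-monoʳ-≤ 1# (0≤fromℕ n))

  fromℕ≉0 : ∀ {n} → 0 ℕ.< n → ¬ (fromℕ n ≈ 0#)
  fromℕ≉0 {suc n} _ fromℕn≈0 = 1≰0 (≤-trans (1≤fromℕ-suc n) (≈⇒≤ fromℕn≈0))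

  fromℕ-cancel-≤ : ∀ {m n} → fromℕ m ≤ fromℕ n → m ℕ.≤ n
  fromℕ-cancel-≤ {zero}  {n}     _  = ℕ.z≤n
  fromℕ-cancel-≤ {suc m} {zero}  le = contradiction (≤-trans (1≤fromℕ-suc m) le) 1≰0
  fromℕ-cancel-≤ {suc m} {suc n} le = ℕ.s≤s (fromℕ-cancel-≤ (+-cancelˡ-≤ 1# le))

  fromℕ-2^ℓ*2^-ℓ : ∀ ℓ → fromℕ (2 ℕ.^ ℓ) * 2^- ℓ ≈ 1#
  fromℕ-2^ℓ*2^-ℓ ℓ = trans (*-cong refl (*-identityˡ _)) (⁻¹-inverse _ (fromℕ≉0 (ℕ.m^n>0 2 ℓ)))

  fromℕ*over : ∀ p {q} → 0 ℕ.< q → fromℕ q * p over q ≈ fromℤ p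
  fromℕ*over p {q} 0<q = begin-equality
    fromℕ q * (fromℤ p * fromℕ q ⁻¹)  ≈⟨ solve 3 (λ a p a⁻¹ → a :* (p :* a⁻¹) := p :* (a :* a⁻¹)) refl (fromℕ q) (fromℤ p) (fromℕ q ⁻¹) ⟩
    fromℤ p * (fromℕ q * fromℕ q ⁻¹)  ≈⟨ *-cong refl (⁻¹-inverse _ (fromℕ≉0 0<q)) ⟩
    fromℤ p * 1#                      ≈⟨ *-identityʳ (fromℤ p) ⟩
    fromℤ p                           ∎

  m*n≤k<m⇒n≤0 : ∀ n {m k} → fromℕ m * fromℤ n ≤ fromℕ k → k ℕ.< m → fromℤ n ≤ 0#
  m*n≤k<m⇒n≤0 (+ zero)  _ _ = ≤-refl
  m*n≤k<m⇒n≤0 -[1+ n ]  _ _ = ≤-trans (neg-antimono-≤ (0≤fromℕ (suc n))) (≈⇒≤ -0#≈0#)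
  m*n≤k<m⇒n≤0 (+ suc n) {m} {k} mn≤k k<m = contradiction m≤k (ℕ.<⇒≱ k<m)
    where
    m≤k : m ℕ.≤ k
    m≤k = ℕ.≤-trans (ℕ.m≤m*n m (suc n)) (fromℕ-cancel-≤ (≤-trans (≈⇒≤ (fromℕ-* m (suc n))) mn≤k))

  IsIntegral : Carrier → Set
  IsIntegral a = Σ ℤ λ n → a ≈ fromℤ n

  ≤-3ε-with-integral-multiple⇒≤0 : ∀ ℓ {t Q} → 0 ℕ.< Q → Q ℕ.* 3 ℕ.< 2 ℕ.^ ℓ →
                                   IsIntegral (fromℕ Q * t) → t ≤ 2^- ℓ + 2^- ℓ + 2^- ℓ → t ≤ 0#
  ≤-3ε-with-integral-multiple⇒≤0 ℓ {t} {Q} 0<Q 3Q<2^ℓ (n , Qt≈n) t≤3ε =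
    k*t≤0⇒t≤0 (0≤fromℕ Q) (fromℕ≉0 0<Q) (≤-trans (≈⇒≤ Qt≈n) (m*n≤k<m⇒n≤0 n 2^ℓn≤3Q 3Q<2^ℓ))
    where
    A ε : Carrier
    A = fromℕ (2 ℕ.^ ℓ)
    ε = 2^- ℓ
    Aε≈1 : A * ε ≈ 1#
    Aε≈1 = fromℕ-2^ℓ*2^-ℓ ℓ
    2^ℓn≤3Q : A * fromℤ n ≤ fromℕ (Q ℕ.* 3)
    2^ℓn≤3Q = begin
      A * fromℤ n                       ≈⟨ *-cong refl Qt≈n ⟨
      A * (fromℕ Q * t)                 ≤⟨ *-monoˡ-≤-nonNeg (0≤fromℕ (2 ℕ.^ ℓ)) (*-monoˡ-≤-nonNeg (0≤fromℕ Q) t≤3ε) ⟩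
      A * (fromℕ Q * (ε + ε + ε))       ≈⟨ solve 3 (λ A Q ε → A :* (Q :* (ε :+ ε :+ ε)) :=
                                             Q :* (A :* ε :+ (A :* ε :+ (A :* ε :+ con (+ 0))))) refl A (fromℕ Q) ε ⟩
      fromℕ Q * (A * ε + (A * ε + (A * ε + 0#)))
                                        ≈⟨ *-cong refl (+-cong Aε≈1 (+-cong Aε≈1 (+-cong Aε≈1 refl))) ⟩
      fromℕ Q * fromℕ 3                 ≈⟨ fromℕ-* Q 3 ⟨
      fromℕ (Q ℕ.* 3)                   ∎

  sum-of-witnesses-≤-3ε : ∀ {x y z s₁ s₂ s₃ ε} → - ε ≤ (x - y) - s₁ → - ε ≤ (y - z) - s₂ →
                          (x - z) - s₃ ≤ ε → (s₁ + s₂) - s₃ ≤ ε + ε + ε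
  sum-of-witnesses-≤-3ε {x} {y} {z} {s₁} {s₂} {s₃} {ε} lo₁ lo₂ hi₃ = begin
    (s₁ + s₂) - s₃                                    ≈⟨ regroup x y z s₁ s₂ s₃ ⟩
    ((x - z) - s₃) + - ((x - y) - s₁) + - ((y - z) - s₂)
        ≤⟨ +-mono₂-≤ (+-mono₂-≤ hi₃ (flip lo₁)) (flip lo₂) ⟩
    ε + ε + ε                                         ∎
    where
    flip : ∀ {a} → - ε ≤ a → - a ≤ ε
    flip -ε≤a = ≤-trans (neg-antimono-≤ -ε≤a) (≈⇒≤ (-‿involutive ε))
    regroup : ∀ x y z s₁ s₂ s₃ →
              (s₁ + s₂) - s₃ ≈ ((x - z) - s₃) + - ((x - y) - s₁) + - ((y - z) - s₂)
    regroup = solve 6 (λ x y z s₁ s₂ s₃ →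
      (s₁ :+ s₂) :- s₃ := ((x :- z) :- s₃) :+ :- ((x :- y) :- s₁) :+ :- ((y :- z) :- s₂)) refl

  denominators-cleared : ∀ p₁ p₂ p₃ {q₁ q₂ q₃} → 0 ℕ.< q₁ → 0 ℕ.< q₂ → 0 ℕ.< q₃ →
    IsIntegral (fromℕ (q₁ ℕ.* q₂ ℕ.* q₃) * ((p₁ over q₁ + p₂ over q₂) - p₃ over q₃))
  denominators-cleared p₁ p₂ p₃ {q₁} {q₂} {q₃} 0<q₁ 0<q₂ 0<q₃ = X₁ ℤ.+ X₂ ℤ.- X₃ , (begin-equality
    fromℕ (q₁ ℕ.* q₂ ℕ.* q₃) * ((s₁ + s₂) - s₃)
      ≈⟨ *-cong (trans (fromℕ-* (q₁ ℕ.* q₂) q₃) (*-cong (fromℕ-* q₁ q₂) refl)) refl ⟩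
    a₁ * a₂ * a₃ * ((s₁ + s₂) - s₃)
      ≈⟨ solve 6 (λ a₁ a₂ a₃ s₁ s₂ s₃ → a₁ :* a₂ :* a₃ :* ((s₁ :+ s₂) :- s₃) :=
           (a₁ :* s₁) :* a₂ :* a₃ :+ (a₂ :* s₂) :* a₁ :* a₃ :- (a₃ :* s₃) :* a₁ :* a₂) refl a₁ a₂ a₃ s₁ s₂ s₃ ⟩
    (a₁ * s₁) * a₂ * a₃ + (a₂ * s₂) * a₁ * a₃ - (a₃ * s₃) * a₁ * a₂
      ≈⟨ +-cong (+-cong (clear p₁ 0<q₁) (clear p₂ 0<q₂)) (-‿cong (clear p₃ 0<q₃)) ⟩
    fromℤ p₁ * a₂ * a₃ + fromℤ p₂ * a₁ * a₃ - fromℤ p₃ * a₁ * a₂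
      ≈⟨ +-cong (+-cong (fromℤ-*₃ p₁ q₂ q₃) (fromℤ-*₃ p₂ q₁ q₃)) (-‿cong (fromℤ-*₃ p₃ q₁ q₂)) ⟨
    fromℤ X₁ + fromℤ X₂ - fromℤ X₃
      ≈⟨ +-cong (fromℤ-+ X₁ X₂) (fromℤ-neg X₃) ⟨
    fromℤ (X₁ ℤ.+ X₂) + fromℤ (ℤ.- X₃)
      ≈⟨ fromℤ-+ (X₁ ℤ.+ X₂) (ℤ.- X₃) ⟨
    fromℤ (X₁ ℤ.+ X₂ ℤ.- X₃)
      ∎)
    where
    a₁ a₂ a₃ s₁ s₂ s₃ : Carrier
    a₁ = fromℕ q₁
    a₂ = fromℕ q₂
    a₃ = fromℕ q₃
    s₁ = p₁ over q₁
    s₂ = p₂ over q₂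
    s₃ = p₃ over q₃
    X₁ X₂ X₃ : ℤ
    X₁ = p₁ ℤ.* + q₂ ℤ.* + q₃
    X₂ = p₂ ℤ.* + q₁ ℤ.* + q₃
    X₃ = p₃ ℤ.* + q₁ ℤ.* + q₂
    clear : ∀ p {q b c} → 0 ℕ.< q → fromℕ q * p over q * b * c ≈ fromℤ p * b * c
    clear p 0<q = *-cong (*-cong (fromℕ*over p 0<q) refl) refl
    fromℤ-*₃ : ∀ p m n → fromℤ (p ℤ.* + m ℤ.* + n) ≈ fromℤ p * fromℕ m * fromℕ n
    fromℤ-*₃ p m n = trans (fromℤ-* (p ℤ.* + m) (+ n)) (*-cong (fromℤ-* p (+ m)) refl)

  ≤-over-trans : ∀ ℓ {x y z} p₁ p₂ p₃ {q₁ q₂ q₃} → 0 ℕ.< q₁ → 0 ℕ.< q₂ → 0 ℕ.< q₃ →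
                 q₁ ℕ.* q₂ ℕ.* q₃ ℕ.* 3 ℕ.< 2 ℕ.^ ℓ →
                 x - y ≤ p₁ over q₁ → ∣ (x - y) - p₁ over q₁ ∣≤ 2^- ℓ →
                 y - z ≤ p₂ over q₂ → ∣ (y - z) - p₂ over q₂ ∣≤ 2^- ℓ →
                 ∣ (x - z) - p₃ over q₃ ∣≤ 2^- ℓ → x - z ≤ p₃ over q₃
  ≤-over-trans ℓ {x} {y} {z} p₁ p₂ p₃ {q₁} {q₂} {q₃} 0<q₁ 0<q₂ 0<q₃ 3Q<2^ℓ
               x-y≤s₁ (lo₁ , _) y-z≤s₂ (lo₂ , _) (_ , hi₃) = begin
    x - z                 ≈⟨ solve 3 (λ x y z → x :- z := (x :- y) :+ (y :- z)) refl x y z ⟩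
    (x - y) + (y - z)     ≤⟨ +-mono₂-≤ x-y≤s₁ y-z≤s₂ ⟩
    s₁ + s₂               ≤⟨ x-y≤0⇒x≤y t≤0 ⟩
    s₃                    ∎
    where
    s₁ s₂ s₃ : Carrier
    s₁ = p₁ over q₁
    s₂ = p₂ over q₂
    s₃ = p₃ over q₃
    t≤0 : (s₁ + s₂) - s₃ ≤ 0#
    t≤0 = ≤-3ε-with-integral-multiple⇒≤0 ℓ (ℕ.*-mono-< (ℕ.*-mono-< 0<q₁ 0<q₂) 0<q₃) 3Q<2^ℓ
            (denominators-cleared p₁ p₂ p₃ 0<q₁ 0<q₂ 0<q₃) (sum-of-witnesses-≤-3ε lo₁ lo₂ hi₃)

open import Data.Nat using (_≤_; _+_; _*_)

lemma12 : (R : RealField) → ∀ (b ℓ : ℕ) → 4 * b + 5 ≤ ℓ →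
    ∀ (x y z : RealField.Carrier R) →
    RealField.Smaller R b ℓ x y → RealField.Smaller R b ℓ y z →
    RealField.Similar R b ℓ x z → RealField.Smaller R b ℓ x z
lemma12 R b ℓ 4b+5≤ℓ x y z ((p₁ , q₁ , w₁@(_ , _ , 0<q₁ , q₁<2^b) , close₁) , x⪯y)
                           ((p₂ , q₂ , w₂@(_ , _ , 0<q₂ , q₂<2^b) , close₂) , y⪯z) x∼z =
  x∼z , x-z≤
  where
  open RealField R using (_-_; InQ; _over_; ∣_∣≤_; 2^-_) renaming (_≤_ to _≤ᴿ_)
  open RealFieldProperties R using (≤-over-trans)
  3b+2≤ℓ : 3 * b + 2 ≤ ℓ
  3b+2≤ℓ = ℕ.≤-trans (ℕ.+-mono-≤ (ℕ.*-monoˡ-≤ b (ℕ.n≤1+n 3)) (ℕ.m≤m+n 2 3)) 4b+5≤ℓ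
  x-z≤ : ∀ p₃ q₃ → InQ (2 ℕ.^ b) p₃ q₃ → ∣ (x - z) - p₃ over q₃ ∣≤ 2^- ℓ → x - z ≤ᴿ p₃ over q₃
  x-z≤ p₃ q₃ (_ , _ , 0<q₃ , q₃<2^b) close₃ =
    ≤-over-trans ℓ p₁ p₂ p₃ 0<q₁ 0<q₂ 0<q₃
      (ℕ.≤-trans (triple-product-bound b q₁<2^b q₂<2^b q₃<2^b) (ℕ.^-monoʳ-≤ 2 3b+2≤ℓ))
      (x⪯y p₁ q₁ w₁ close₁) close₁ (y⪯z p₂ q₂ w₂ close₂) close₂ close₃
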